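{- Let $D$ be a digraph with $n$ vertices and $n$ arcs, and let $f$ be a super edge-magic labeling of $D$. Let $h:E(D)\to\mathcal{S}_p^k$ be any function. Then there exists $\bar h:E(D)\to\mathcal{S}_p^{p+3-k}$ such that $\overline{\widehat{o(f)}}\simeq\widehat{e(f_c)}$, where $\overline{\widehat{o(f)}}$ is the complementary labeling of the labeling of $D\otimes_h\mathcal{S}_p^k$ induced by $o(f)$, and $\widehat{e(f_c)}$ is the labeling of $D\otimes_{\bar h}\mathcal{S}_p^{p+3-k}$ induced by $e(f_c)$.
   Context: Digraphs may have loops but no multiple arcs. $[a,b]=\{a,\dots,b\}$. An edge-magic labeling of a $(p,q)$-(di)graph $G$ is a bijection $f:V(G)\cup E(G)\to[1,p+q]$ with $f(x)+f(xy)+f(y)=\mathrm{val}(f)$ constant over edges; super if $f(V(G))=[1,p]$. Complementary labeling: $\overline f(x)=p+q+1-f(x)$. The super edge-magic complementary labeling $f_c$ of a super edge-magic labeling $f$ of a $(p,q)$-graph is $f_c(x)=p+1-f(x)$ on vertices and $f_c(xy)=2p+q+1-f(xy)$ on edges (a super edge-magic labeling of valence $4p+q+3-\mathrm{val}(f)$). For a super edge-magic labeling $f$ of an $(n,n)$-(di)graph, the odd and even labelings are $o(f)(x)=2f(x)-1$, $e(f)(x)=2f(x)$ on vertices and $o(f)(xy)=2\mathrm{val}(f)-2n-2-o(f)(x)-o(f)(y)$, $e(f)(xy)=2\mathrm{val}(f)-2n-1-e(f)(x)-e(f)(y)$ on edges; both are edge-magic labelings. $\mathcal{S}_p^k$: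 the set of digraphs $F$ with vertex set $[1,p]$, exactly $p$ arcs, and $\{i+j:(i,j)\in E(F)\}=[k,k+p-1]$. For $h$ from $E(D)$ to a family of digraphs with common vertex set $V$, $D\otimes_h\Gamma$ has vertex set $V(D)\times V$ and arcs $((a,i),(b,j))$ with $(a,b)\in E(D)$, $(i,j)\in E(h(a,b))$. For an edge-magic labeling $g$ of $D$ and $h:E(D)\to\mathcal{S}_p^k$, the induced labeling $\hat g$ of $D\otimes_h\mathcal{S}_p^k$ is $\hat g(a,i)=p(g(a)-1)+i$, $\hat g((a,i),(b,j))=p(g((a,b))-1)+k+p-(i+j)$. $\simeq$ means there is a digraph isomorphism carrying one labeling to the other. -}

module Defs where

open import Data.Nat using (ℕ; zero; suc; _+_; _*_; _∸_; _≤_; _<_)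
open import Data.Fin using (Fin; toℕ)
open import Data.Product using (Σ; _×_; _,_; proj₁; proj₂)
open import Data.List using (List; map; _++_; length; concatMap; allFin)
open import Data.List.Membership.Propositional using (_∈_)
open import Data.List.Relation.Unary.Unique.Propositional using (Unique)
open import Function.Bundles using (_⇔_; _↔_; Inverse)
open import Relation.Binary.PropositionalEquality using (_≡_)

-- A labeling of a digraph with vertex type V and no multiple arcs:
-- a label for every vertex, and a label for the arc (x , y) (only
-- meaningful when (x , y) is an arc).
record Labeling (V : Set) : Set where
  constructor lab
  field
    vl : V → ℕ
    el : V → V → ℕ
open Labeling public

labels : {V : Set} → List V → List (V × V) → Labeling V → List ℕ
labels vs es f = map (vl f) vs ++ map (λ e → el f (proj₁ e) (proj₂ e)) es

-- Super edge-magic labeling of the (p,q)-digraph (vs, es) with valence val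
-- (vs lists each vertex exactly once, es lists each arc exactly once).
record IsSuperEdgeMagic {V : Set} (vs : List V) (es : List (V × V))
                        (f : Labeling V) (val : ℕ) : Set where
  field
    injective  : Unique (labels vs es f)
    onto       : ∀ m → m ∈ labels vs es f ⇔ (1 ≤ m × m ≤ length vs + length es)
    magic      : ∀ x y → (x , y) ∈ es → vl f x + el f x y + vl f y ≡ val
    super      : ∀ m → m ∈ map (vl f) vs ⇔ (1 ≤ m × m ≤ length vs)

-- Vertex i : Fin p of a digraph in S_p^k stands for the integer toℕ i + 1 ∈ [1,p].
val1 : {p : ℕ} → Fin p → ℕ
val1 i = suc (toℕ i)

arcSum : {p : ℕ} → Fin p × Fin p → ℕ
arcSum (i , j) = val1 i + val1 j

InS : (p k : ℕ) → List (Fin p × Fin p) → Set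
InS p k F = Unique F × length F ≡ p ×
            (∀ m → m ∈ map arcSum F ⇔ (k ≤ m × m < k + p))

ProdArc : {n p : ℕ} → List (Fin n × Fin n) → (Fin n × Fin n → List (Fin p × Fin p))
        → (Fin n × Fin p) → (Fin n × Fin p) → Set
ProdArc A h (a , i) (b , j) = ((a , b) ∈ A) × ((i , j) ∈ h (a , b))

prodArcs : {n p : ℕ} → List (Fin n × Fin n) → (Fin n × Fin n → List (Fin p × Fin p))
         → List ((Fin n × Fin p) × (Fin n × Fin p))
prodArcs A h = concatMap (λ e → map (λ ij → ((proj₁ e , proj₁ ij) , (proj₂ e , proj₂ ij))) (h e)) A

complement : {V : Set} → (P Q : ℕ) → Labeling V → Labeling V
complement P Q f = lab (λ x → P + Q + 1 ∸ vl f x) (λ x y → P + Q + 1 ∸ el f x y)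

superComplement : {V : Set} → (p q : ℕ) → Labeling V → Labeling V
superComplement p q f = lab (λ x → p + 1 ∸ vl f x) (λ x y → 2 * p + q + 1 ∸ el f x y)

oddLab : {V : Set} → (n val : ℕ) → Labeling V → Labeling V
oddLab n val f = lab ov (λ x y → 2 * val ∸ 2 * n ∸ 2 ∸ ov x ∸ ov y)
  where ov = λ x → 2 * vl f x ∸ 1

evenLab : {V : Set} → (n val : ℕ) → Labeling V → Labeling V
evenLab n val f = lab ev (λ x y → 2 * val ∸ 2 * n ∸ 1 ∸ ev x ∸ ev y)
  where ev = λ x → 2 * vl f x

induced : {n : ℕ} → (p k : ℕ) → Labeling (Fin n) → Labeling (Fin n × Fin p)
induced p k g = lab (λ x → p * (vl g (proj₁ x) ∸ 1) + val1 (proj₂ x))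
                    (λ x y → p * (el g (proj₁ x) (proj₁ y) ∸ 1)
                             + (k + p ∸ (val1 (proj₂ x) + val1 (proj₂ y))))

record LabIso {V W : Set} (R : V → V → Set) (f : Labeling V)
              (S : W → W → Set) (g : Labeling W) : Set where
  field
    φ      : V ↔ W
    arcs   : ∀ x y → R x y ⇔ S (Inverse.to φ x) (Inverse.to φ y)
    vlabel : ∀ x → vl f x ≡ vl g (Inverse.to φ x)
    elabel : ∀ x y → R x y → el f x y ≡ el g (Inverse.to φ x) (Inverse.to φ y)

-- Take h̄ e to be h e with both ends of every arc reflected by i ↦ p + 1 − i, and
-- φ (a , i) = (a , p + 1 − i).  The reflection sends an arc sum σ to 2p + 2 − σ, and
-- k ≤ p + 1 (arc sums are at most 2p), so [k, k + p − 1] is carried onto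
-- [p + 3 − k, 2p + 2 − k]: h̄ lands in S_p^(p+3−k).  For the labels, o(f) and
-- e(f_c) are complementary on D (they add up to 2n + 1 on every vertex and arc), and
-- an induced label is p (g − 1) + r with r ∈ [1, p]; complementing it within
-- [1, 2np] replaces g by 2n + 1 − g and r by p + 1 − r, which is the label of
-- φ x under the labeling induced by e(f_c).

module Submission where

open import Defs
open import Data.Nat using (ℕ; zero; suc; _+_; _*_; _∸_; _≤_; _<_; z≤n; s≤s; s≤s⁻¹)
open import Data.Nat.Properties
open import Data.Nat.Tactic.RingSolver using (solve)
open import Algebra.Properties.CommutativeSemigroup +-commutativeSemigroup using (interchange)
open import Data.Fin using (Fin; toℕ; opposite)
open import Data.Fin.Properties using (toℕ<n; opposite-prop; opposite-involutive)
open import Data.Product using (Σ; _×_; _,_; proj₁; proj₂; map₂)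
import Data.Product as Product
open import Data.List using (List; []; _∷_; map; _++_; length; allFin)
open import Data.List.Properties using (length-map; length-++; length-tabulate)
open import Data.List.Membership.Propositional using (_∈_)
open import Data.List.Membership.Propositional.Properties using (∈-map⁺; ∈-map⁻; ∈-++⁺ʳ; ∈-allFin)
open import Data.List.Relation.Unary.Any using (here; there)
open import Data.List.Relation.Unary.All using (lookup)
open import Data.List.Relation.Unary.All.Properties using (++⁻ʳ)
open import Data.List.Relation.Unary.AllPairs using ([]; _∷_)
open import Data.List.Relation.Unary.Unique.Propositional using (Unique)
import Data.List.Relation.Unary.Unique.Propositional.Properties as Unique
open import Data.Empty using (⊥; ⊥-elim)
open import Function.Bundles using (_⇔_; mk⇔; mk↔ₛ′; Equivalence)
open import Function.Construct.Identity using (⇔-id)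
open import Data.Product.Function.NonDependent.Propositional using (_×-⇔_)
open import Relation.Binary.PropositionalEquality
  using (_≡_; refl; sym; trans; cong; cong₂; subst; subst₂; module ≡-Reasoning)
open ≡-Reasoning
open Equivalence using (to; from)

length-allFin : ∀ n → length (allFin n) ≡ n
length-allFin n = length-tabulate {n = n} (λ i → i)

Unique-++⇒disjoint : ∀ {A : Set} {xs ys : List A} {x} → Unique (xs ++ ys) → x ∈ xs → x ∈ ys → ⊥
Unique-++⇒disjoint {xs = _ ∷ xs} (x∉ ∷ _)     (here refl)  x∈ys = lookup (++⁻ʳ xs x∉) x∈ys refl
Unique-++⇒disjoint {xs = _ ∷ _}  (_ ∷ unique) (there x∈xs) x∈ys = Unique-++⇒disjoint unique x∈xs x∈ys

involutive⇒injective : ∀ {A : Set} {f : A → A} → (∀ x → f (f x) ≡ x) → ∀ {x y} → f x ≡ f y → x ≡ y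
involutive⇒injective {f = f} involutive {x} {y} fx≡fy =
  trans (sym (involutive x)) (trans (cong f fx≡fy) (involutive y))

∈-map-involutive : ∀ {A : Set} {f : A → A} → (∀ x → f (f x) ≡ x) → ∀ {x xs} → x ∈ xs ⇔ f x ∈ map f xs
∈-map-involutive {f = f} involutive {x} {xs} = mk⇔ (∈-map⁺ f) ∈-map⁻-involutive
  where
  ∈-map⁻-involutive : f x ∈ map f xs → x ∈ xs
  ∈-map⁻-involutive fx∈ with ∈-map⁻ f fx∈
  ... | y , y∈xs , fx≡fy = subst (_∈ xs) (sym (involutive⇒injective involutive fx≡fy)) y∈xs

∸-exact : ∀ m {n o} → m + n ≡ o → o ∸ m ≡ n
∸-exact m refl = m+n∸m≡n m _

∸-exact⁴ : ∀ a b c d e {r} → b + c + d + e + r ≡ a → a ∸ b ∸ c ∸ d ∸ e ≡ r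
∸-exact⁴ a b c d e {r} eq = begin
  a ∸ b ∸ c ∸ d ∸ e     ≡⟨ cong (λ t → t ∸ d ∸ e) (∸-+-assoc a b c) ⟩
  a ∸ (b + c) ∸ d ∸ e   ≡⟨ cong (_∸ e) (∸-+-assoc a (b + c) d) ⟩
  a ∸ (b + c + d) ∸ e   ≡⟨ ∸-+-assoc a (b + c + d) e ⟩
  a ∸ (b + c + d + e)   ≡⟨ ∸-exact (b + c + d + e) eq ⟩
  r                     ∎

2*suc∸1 : ∀ x → 2 * suc x ∸ 1 ≡ suc (2 * x)
2*suc∸1 x = cong (_∸ 1) (*-suc 2 x)

≤-transfer : ∀ {a b c d} → a + b ≡ c + d → c ≤ a → b ≤ d
≤-transfer {a} {b} {c} {d} eq c≤a = +-cancelˡ-≤ c b d (subst (c + b ≤_) eq (+-monoˡ-≤ b c≤a))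

interval-reflect : ∀ {k k̄ p s s̄} → s + s̄ ≡ k + k̄ + p →
  k ≤ s × s < k + suc p → k̄ ≤ s̄ × s̄ < k̄ + suc p
interval-reflect {k} {k̄} {p} {s} {s̄} eq (k≤s , s<k+1+p) =
  ≤-transfer eq′ (s≤s⁻¹ (subst (s <_) (+-suc k p) s<k+1+p)) ,
  subst (s̄ <_) (sym (+-suc k̄ p)) (s≤s (≤-transfer (trans eq (+-assoc k k̄ p)) k≤s))
  where
  eq′ : k + p + k̄ ≡ s + s̄
  eq′ = begin
    k + p + k̄  ≡⟨ solve (k ∷ p ∷ k̄ ∷ []) ⟩
    k + k̄ + p  ≡⟨ sym eq ⟩
    s + s̄      ∎

interval-reflect-onto : ∀ {k k̄ p m} → k̄ ≤ m × m < k̄ + suc p →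
  Σ ℕ λ s → (k ≤ s × s < k + suc p) × s + m ≡ k + k̄ + p
interval-reflect-onto {k} {k̄} {p} {m} m∈Ī@(_ , m<k̄+1+p) =
  k + k̄ + p ∸ m , interval-reflect swapped m∈Ī , s+m≡total
  where
  m≤total : m ≤ k + k̄ + p
  m≤total = subst (m ≤_) (sym (+-assoc k k̄ p))
    (≤-trans (s≤s⁻¹ (subst (m <_) (+-suc k̄ p) m<k̄+1+p)) (m≤n+m (k̄ + p) k))
  s+m≡total : k + k̄ + p ∸ m + m ≡ k + k̄ + p
  s+m≡total = m∸n+n≡m m≤total
  swapped : m + (k + k̄ + p ∸ m) ≡ k̄ + k + p
  swapped = trans (+-comm m _) (trans s+m≡total (cong (_+ p) (+-comm k k̄)))

offsets-complementary : ∀ {k k̄ p s s̄} → s + s̄ ≡ k + k̄ + p → k ≤ s → s < k + suc p →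
  (k + suc p ∸ s) + (k̄ + suc p ∸ s̄) ≡ suc (suc p)
offsets-complementary {k} {k̄} {p} {s} {s̄} eq k≤s s<k+1+p with m≤n⇒∃[o]m+o≡n k≤s
... | d , refl with m≤n⇒∃[o]m+o≡n (s≤s⁻¹ (+-cancelˡ-< k d (suc p) s<k+1+p))
... | e , refl with +-cancelˡ-≡ (k + d) s̄ (k̄ + e) (begin
      k + d + s̄            ≡⟨ eq ⟩
      k + k̄ + (d + e)      ≡⟨ solve (k ∷ k̄ ∷ d ∷ e ∷ []) ⟩
      k + d + (k̄ + e)      ∎)
... | refl = begin
  (k + suc (d + e) ∸ (k + d)) + (k̄ + suc (d + e) ∸ (k̄ + e))
    ≡⟨ cong₂ _+_ (∸-exact (k + d) left) (∸-exact (k̄ + e) right) ⟩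
  suc e + suc d
    ≡⟨ solve (d ∷ e ∷ []) ⟩
  suc (suc (d + e)) ∎
  where
  left : k + d + suc e ≡ k + suc (d + e)
  left = solve (k ∷ d ∷ e ∷ [])
  right : k̄ + e + suc d ≡ k̄ + suc (d + e)
  right = solve (k̄ ∷ d ∷ e ∷ [])

-- p * α + r is the label given by `induced` to a vertex or arc with block label
-- α + 1 and fibre label r ∈ [1, p].
complement-induced : ∀ n p {Q} α α′ r r′ → Q ≡ n * p → α + suc α′ ≡ 2 * n → r + r′ ≡ suc p →
                     n * p + Q + 1 ∸ (p * α + r) ≡ p * α′ + r′
complement-induced n p α α′ r r′ refl hα hr = ∸-exact (p * α + r) (begin
  p * α + r + (p * α′ + r′)  ≡⟨ solve (p ∷ α ∷ α′ ∷ r ∷ r′ ∷ []) ⟩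
  p * α + p * α′ + (r + r′)  ≡⟨ cong (p * α + p * α′ +_) hr ⟩
  p * α + p * α′ + suc p     ≡⟨ solve (p ∷ α ∷ α′ ∷ []) ⟩
  p * (α + suc α′) + 1       ≡⟨ cong (λ t → p * t + 1) hα ⟩
  p * (2 * n) + 1            ≡⟨ solve (n ∷ p ∷ []) ⟩
  n * p + n * p + 1          ∎)

-- o(f) and e(f_c) add up to 2n + 1 on every vertex (here) and arc
-- (arc-labels-complementary), stated for the block indices `label ∸ 1` of `induced`.
vertex-labels-complementary : ∀ {n m} → 1 ≤ m × m ≤ n →
  (2 * m ∸ 1 ∸ 1) + suc (2 * (n + 1 ∸ m) ∸ 1) ≡ 2 * n
vertex-labels-complementary {m = suc x} (_ , m≤n) with m≤n⇒∃[o]m+o≡n m≤n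
... | u , refl = begin
  2 * suc x ∸ 1 ∸ 1 + suc (2 * (suc x + u + 1 ∸ suc x) ∸ 1)
    ≡⟨ cong₂ (λ a b → a ∸ 1 + suc (2 * b ∸ 1)) (2*suc∸1 x) reflected ⟩
  2 * x + suc (2 * suc u ∸ 1)
    ≡⟨ cong (λ b → 2 * x + suc b) (2*suc∸1 u) ⟩
  2 * x + suc (suc (2 * u))
    ≡⟨ solve (x ∷ u ∷ []) ⟩
  2 * (suc x + u) ∎
  where
  reflected : suc x + u + 1 ∸ suc x ≡ suc u
  reflected = ∸-exact (suc x) (trans (cong (suc x +_) (+-comm 1 u)) (sym (+-assoc (suc x) u 1)))

excess-complementary : ∀ {n F} → n < F → F ≤ n + n →
  (2 * (F ∸ n) ∸ 1) + suc (2 * (n + n ∸ F)) ≡ 2 * n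
excess-complementary {n} n<F F≤2n with m≤n⇒∃[o]m+o≡n n<F
... | z , refl with m≤n⇒∃[o]m+o≡n F≤2n
... | w , F+w≡2n = begin
  2 * (suc n + z ∸ n) ∸ 1 + suc (2 * (n + n ∸ (suc n + z)))
    ≡⟨ cong₂ (λ a b → 2 * a ∸ 1 + suc (2 * b)) excess slack ⟩
  2 * suc z ∸ 1 + suc (2 * w)
    ≡⟨ cong (_+ suc (2 * w)) (2*suc∸1 z) ⟩
  suc (2 * z) + suc (2 * w)
    ≡⟨ solve (z ∷ w ∷ []) ⟩
  2 * (suc z + w)
    ≡⟨ cong (2 *_) (+-cancelˡ-≡ n _ _ (trans shift F+w≡2n)) ⟩
  2 * n ∎
  where
  excess : suc n + z ∸ n ≡ suc z
  excess = ∸-exact n (+-suc n z)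
  slack : n + n ∸ (suc n + z) ≡ w
  slack = ∸-exact (suc n + z) F+w≡2n
  shift : n + (suc z + w) ≡ suc n + z + w
  shift = solve (n ∷ z ∷ w ∷ [])

oddLab-arc : ∀ {n fa F fb val} → fa + F + fb ≡ val → 1 ≤ fa → 1 ≤ fb → n ≤ F →
  2 * val ∸ 2 * n ∸ 2 ∸ (2 * fa ∸ 1) ∸ (2 * fb ∸ 1) ≡ 2 * (F ∸ n)
oddLab-arc {n} {suc x} {F} {suc y} refl _ _ n≤F with m≤n⇒∃[o]m+o≡n n≤F
... | t , refl = begin
  2 * (suc x + (n + t) + suc y) ∸ 2 * n ∸ 2 ∸ (2 * suc x ∸ 1) ∸ (2 * suc y ∸ 1)
    ≡⟨ cong₂ (λ a b → 2 * (suc x + (n + t) + suc y) ∸ 2 * n ∸ 2 ∸ a ∸ b) (2*suc∸1 x) (2*suc∸1 y) ⟩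
  2 * (suc x + (n + t) + suc y) ∸ 2 * n ∸ 2 ∸ suc (2 * x) ∸ suc (2 * y)
    ≡⟨ ∸-exact⁴ _ (2 * n) 2 (suc (2 * x)) (suc (2 * y)) (solve (n ∷ x ∷ y ∷ t ∷ [])) ⟩
  2 * t
    ≡⟨ cong (2 *_) (sym (m+n∸m≡n n t)) ⟩
  2 * (n + t ∸ n) ∎

evenLab-superComplement-arc : ∀ {n fa F fb val} → fa + F + fb ≡ val → fa ≤ n → fb ≤ n → F ≤ n + n →
  2 * (4 * n + n + 3 ∸ val) ∸ 2 * n ∸ 1 ∸ 2 * (n + 1 ∸ fa) ∸ 2 * (n + 1 ∸ fb) ≡ suc (2 * (n + n ∸ F))
evenLab-superComplement-arc {n} {fa} {F} {fb} refl fa≤n fb≤n F≤2n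
  with m≤n⇒∃[o]m+o≡n fa≤n | m≤n⇒∃[o]m+o≡n fb≤n | m≤n⇒∃[o]m+o≡n F≤2n
... | u , fa+u≡n | v , fb+v≡n | w , F+w≡2n = begin
  2 * (4 * n + n + 3 ∸ (fa + F + fb)) ∸ 2 * n ∸ 1 ∸ 2 * (n + 1 ∸ fa) ∸ 2 * (n + 1 ∸ fb)
    ≡⟨ cong₂ (λ a b → 2 * a ∸ 2 * n ∸ 1 ∸ b ∸ 2 * (n + 1 ∸ fb)) valence (cong (2 *_) (reflect fa+u≡n)) ⟩
  2 * (u + v + w + n + 3) ∸ 2 * n ∸ 1 ∸ 2 * suc u ∸ 2 * (n + 1 ∸ fb)
    ≡⟨ cong (λ b → 2 * (u + v + w + n + 3) ∸ 2 * n ∸ 1 ∸ 2 * suc u ∸ 2 * b) (reflect fb+v≡n) ⟩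
  2 * (u + v + w + n + 3) ∸ 2 * n ∸ 1 ∸ 2 * suc u ∸ 2 * suc v
    ≡⟨ ∸-exact⁴ _ (2 * n) 1 (2 * suc u) (2 * suc v) (solve (n ∷ u ∷ v ∷ w ∷ [])) ⟩
  suc (2 * w)
    ≡⟨ cong (λ b → suc (2 * b)) (sym (∸-exact F F+w≡2n)) ⟩
  suc (2 * (n + n ∸ F)) ∎
  where
  reflect : ∀ {m d} → m + d ≡ n → n + 1 ∸ m ≡ suc d
  reflect {m} {d} m+d≡n = ∸-exact m (trans (+-suc m d) (trans (cong suc m+d≡n) (+-comm 1 n)))
  valence : 4 * n + n + 3 ∸ (fa + F + fb) ≡ u + v + w + n + 3
  valence = ∸-exact (fa + F + fb) (begin
    fa + F + fb + (u + v + w + n + 3)       ≡⟨ solve (fa ∷ F ∷ fb ∷ u ∷ v ∷ w ∷ n ∷ []) ⟩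
    (fa + u) + (fb + v) + (F + w) + n + 3   ≡⟨ cong₂ (λ a b → a + b + (F + w) + n + 3) fa+u≡n fb+v≡n ⟩
    n + n + (F + w) + n + 3                 ≡⟨ cong (λ c → n + n + c + n + 3) F+w≡2n ⟩
    n + n + (n + n) + n + 3                 ≡⟨ solve (n ∷ []) ⟩
    4 * n + n + 3                           ∎)

arc-labels-complementary : ∀ {n fa F fb val} → fa + F + fb ≡ val →
  1 ≤ fa × fa ≤ n → 1 ≤ fb × fb ≤ n → n < F × F ≤ n + n →
  (2 * val ∸ 2 * n ∸ 2 ∸ (2 * fa ∸ 1) ∸ (2 * fb ∸ 1) ∸ 1)
    + suc (2 * (4 * n + n + 3 ∸ val) ∸ 2 * n ∸ 1 ∸ 2 * (n + 1 ∸ fa) ∸ 2 * (n + 1 ∸ fb) ∸ 1)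
  ≡ 2 * n
arc-labels-complementary magic (1≤fa , fa≤n) (1≤fb , fb≤n) (n<F , F≤2n)
  rewrite oddLab-arc magic 1≤fa 1≤fb (<⇒≤ n<F) | evenLab-superComplement-arc magic fa≤n fb≤n F≤2n
  = excess-complementary n<F F≤2n

module _ {n val} {A : List (Fin n × Fin n)} {f : Labeling (Fin n)}
         (sem : IsSuperEdgeMagic (allFin n) A f val) where
  open IsSuperEdgeMagic sem

  vertexLabel-range : ∀ a → 1 ≤ vl f a × vl f a ≤ n
  vertexLabel-range a =
    map₂ (subst (vl f a ≤_) (length-allFin n)) (to (super (vl f a)) (∈-map⁺ (vl f) (∈-allFin a)))

  arcLabel-range : length A ≡ n → ∀ {a b} → (a , b) ∈ A → n < el f a b × el f a b ≤ n + n
  arcLabel-range lenA {a} {b} ab∈A =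
    ≰⇒> notVertexLabel , subst (el f a b ≤_) (cong₂ _+_ (length-allFin n) lenA) (proj₂ range)
    where
    arcLabel∈ : el f a b ∈ map (λ e → el f (proj₁ e) (proj₂ e)) A
    arcLabel∈ = ∈-map⁺ _ ab∈A
    range : 1 ≤ el f a b × el f a b ≤ length (allFin n) + length A
    range = to (onto (el f a b)) (∈-++⁺ʳ _ arcLabel∈)
    notVertexLabel : el f a b ≤ n → ⊥
    notVertexLabel F≤n = Unique-++⇒disjoint injective
      (from (super (el f a b)) (proj₁ range , subst (el f a b ≤_) (sym (length-allFin n)) F≤n))
      arcLabel∈

length-prodArcs : ∀ {n p} (h : Fin n × Fin n → List (Fin p × Fin p)) (B : List (Fin n × Fin n)) →
  (∀ e → e ∈ B → length (h e) ≡ p) → length (prodArcs B h) ≡ length B * p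
length-prodArcs h []      _       = refl
length-prodArcs {p = p} h (e ∷ B) lengths = begin
  length (map _ (h e) ++ prodArcs B h)          ≡⟨ length-++ (map _ (h e)) ⟩
  length (map _ (h e)) + length (prodArcs B h)  ≡⟨ cong₂ _+_ (trans (length-map _ (h e)) (lengths e (here refl)))
                                                             (length-prodArcs h B (λ e′ e′∈B → lengths e′ (there e′∈B))) ⟩
  p + length B * p                              ∎

val1-opposite : ∀ {p} (i : Fin p) → val1 i + val1 (opposite i) ≡ suc p
val1-opposite {p} i = begin
  suc (toℕ i) + suc (toℕ (opposite i))   ≡⟨ cong (λ t → suc (toℕ i) + suc t) (opposite-prop i) ⟩
  suc (toℕ i) + suc (p ∸ suc (toℕ i))    ≡⟨ +-suc (suc (toℕ i)) _ ⟩
  suc (suc (toℕ i) + (p ∸ suc (toℕ i)))  ≡⟨ cong suc (m+[n∸m]≡n (toℕ<n i)) ⟩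
  suc p                                  ∎

oppositeArc : ∀ {p} → Fin p × Fin p → Fin p × Fin p
oppositeArc = Product.map opposite opposite

oppositeArc-involutive : ∀ {p} (q : Fin p × Fin p) → oppositeArc (oppositeArc q) ≡ q
oppositeArc-involutive (i , j) = cong₂ _,_ (opposite-involutive i) (opposite-involutive j)

arcSum-oppositeArc : ∀ {p} (q : Fin p × Fin p) → arcSum q + arcSum (oppositeArc q) ≡ suc p + suc p
arcSum-oppositeArc {p} (i , j) = begin
  val1 i + val1 j + (val1 (opposite i) + val1 (opposite j))
    ≡⟨ interchange (val1 i) (val1 j) (val1 (opposite i)) (val1 (opposite j)) ⟩
  val1 i + val1 (opposite i) + (val1 j + val1 (opposite j))
    ≡⟨ cong₂ _+_ (val1-opposite i) (val1-opposite j) ⟩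
  suc p + suc p ∎

arcSum≤ : ∀ {p} (q : Fin p × Fin p) → arcSum q ≤ p + p
arcSum≤ (i , j) = +-mono-≤ (toℕ<n i) (toℕ<n j)

InS⇒start≤ : ∀ {p k F} → InS (suc p) k F → k ≤ suc p + 1
InS⇒start≤ {p} {k} (_ , _ , sums)
  with ∈-map⁻ arcSum (from (sums (k + p)) (m≤m+n k p , +-monoʳ-< k (n<1+n p)))
... | q , _ , k+p≡sum = +-cancelʳ-≤ p k (suc p + 1) (subst₂ _≤_ (sym k+p≡sum) total (arcSum≤ q))
  where
  total : suc p + suc p ≡ suc p + 1 + p
  total = solve (p ∷ [])

arcSum-reflection : ∀ {p k} → k ≤ suc p + 1 → (q : Fin (suc p) × Fin (suc p)) →
  arcSum q + arcSum (oppositeArc q) ≡ k + (suc p + 3 ∸ k) + p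
arcSum-reflection {p} {k} k≤ q = begin
  arcSum q + arcSum (oppositeArc q)  ≡⟨ arcSum-oppositeArc q ⟩
  suc (suc p) + suc (suc p)          ≡⟨ solve (p ∷ []) ⟩
  suc p + 3 + p                      ≡⟨ cong (_+ p) (sym (m+[n∸m]≡n (≤-trans k≤ (+-monoʳ-≤ (suc p) (s≤s z≤n))))) ⟩
  k + (suc p + 3 ∸ k) + p            ∎

arcOffsets-complementary : ∀ {p k F} → InS p k F → ∀ {q} → q ∈ F →
  (k + p ∸ arcSum q) + (p + 3 ∸ k + p ∸ arcSum (oppositeArc q)) ≡ suc p
arcOffsets-complementary {zero} _ {() , _}
arcOffsets-complementary {suc p} {k} S@(_ , _ , sums) {q} q∈F =
  offsets-complementary (arcSum-reflection (InS⇒start≤ S) q) (proj₁ interval) (proj₂ interval)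
  where
  interval : k ≤ arcSum q × arcSum q < k + suc p
  interval = to (sums (arcSum q)) (∈-map⁺ arcSum q∈F)

InS-opposite : ∀ {p k F} → InS p k F → InS p (p + 3 ∸ k) (map oppositeArc F)
InS-opposite {zero} {F = []} _ =
  [] , refl , λ m → mk⇔ (λ ()) λ (k̄≤m , m<k̄+0) → ⊥-elim (<⇒≱ (subst (m <_) (+-identityʳ _) m<k̄+0) k̄≤m)
InS-opposite {zero} {F = _ ∷ _} (_ , () , _)
InS-opposite {suc p} {k} {F} S@(unique , len , sums) =
  Unique.map⁺ (involutive⇒injective oppositeArc-involutive) unique ,
  trans (length-map oppositeArc F) len ,
  λ m → mk⇔ (reflected m) (unreflected m)
  where
  k̄ = suc p + 3 ∸ k
  total : ∀ q → arcSum q + arcSum (oppositeArc q) ≡ k + k̄ + p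
  total = arcSum-reflection (InS⇒start≤ S)
  reflected : ∀ m → m ∈ map arcSum (map oppositeArc F) → k̄ ≤ m × m < k̄ + suc p
  reflected m m∈ with ∈-map⁻ arcSum m∈
  ... | q̄ , q̄∈ , refl with ∈-map⁻ oppositeArc q̄∈
  ... | q , q∈F , refl = interval-reflect (total q) (to (sums (arcSum q)) (∈-map⁺ arcSum q∈F))
  unreflected : ∀ m → k̄ ≤ m × m < k̄ + suc p → m ∈ map arcSum (map oppositeArc F)
  unreflected m m∈Ī with interval-reflect-onto {k} m∈Ī
  ... | s , s∈I , s+m≡total with ∈-map⁻ arcSum (from (sums s) s∈I)
  ... | q , q∈F , refl =
    subst (_∈ map arcSum (map oppositeArc F))
          (+-cancelˡ-≡ (arcSum q) _ _ (trans (total q) (sym s+m≡total)))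
          (∈-map⁺ arcSum (∈-map⁺ oppositeArc q∈F))

corollary2p4 : (n p k : ℕ) (A : List (Fin n × Fin n)) → Unique A → length A ≡ n →
    (f : Labeling (Fin n)) (val : ℕ) → IsSuperEdgeMagic (allFin n) A f val →
    (h : Fin n × Fin n → List (Fin p × Fin p)) → (∀ e → e ∈ A → InS p k (h e)) →
    Σ (Fin n × Fin n → List (Fin p × Fin p)) λ h̄ →
      (∀ e → e ∈ A → InS p (p + 3 ∸ k) (h̄ e)) ×
      LabIso (ProdArc A h)
             (complement (n * p) (length (prodArcs A h)) (induced p k (oddLab n val f)))
             (ProdArc A h̄)
             (induced p (p + 3 ∸ k) (evenLab n (4 * n + n + 3 ∸ val) (superComplement n n f)))
corollary2p4 n p k A _ lenA f val sem h h∈S =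
  (λ e → map oppositeArc (h e)) ,
  (λ e e∈A → InS-opposite (h∈S e e∈A)) ,
  record
    { φ      = mk↔ₛ′ φ φ φ-involutive φ-involutive
    ; arcs   = λ _ _ → ⇔-id _ ×-⇔ ∈-map-involutive oppositeArc-involutive
    ; vlabel = λ { (a , i) →
        complement-induced n p _ _ _ _ arcCount
          (vertex-labels-complementary (vertexLabel-range sem a))
          (val1-opposite i) }
    ; elabel = λ { (a , i) (b , j) (ab∈A , ij∈h) →
        complement-induced n p _ _ _ _ arcCount
          (arc-labels-complementary (magic a b ab∈A)
             (vertexLabel-range sem a) (vertexLabel-range sem b) (arcLabel-range sem lenA ab∈A))
          (arcOffsets-complementary (h∈S (a , b) ab∈A) ij∈h) }
    }
  where
  open IsSuperEdgeMagic sem using (magic)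
  φ : Fin n × Fin p → Fin n × Fin p
  φ = map₂ opposite
  φ-involutive : ∀ x → φ (φ x) ≡ x
  φ-involutive (a , i) = cong (a ,_) (opposite-involutive i)
  arcCount : length (prodArcs A h) ≡ n * p
  arcCount = trans (length-prodArcs h A (λ e e∈A → proj₁ (proj₂ (h∈S e e∈A)))) (cong (_* p) lenA)
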